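{- Let $\mathbb{F}$ be a field and let $t\in \mathbb{F}^{2\times 2}\otimes\mathbb{F}^{2\times 2}\otimes\mathbb{F}^{2\times 2}$ be a tensor with the same support as the matrix multiplication tensor $\langle 2,2,2\rangle$. Then there is a tensor $s$ in the $\mathrm{GL}_4(\mathbb{F})^{\times 3}$-orbit of $t$, with the same support as $t$, such that every nonzero coefficient of $s$ equals $1$, except possibly the coefficient of $e_{11}\otimes e_{11}\otimes e_{11}$.
   Context: Let $e_{11},e_{12},e_{21},e_{22}$ be the standard basis of the space $\mathbb{F}^{2\times 2}$ of $2\times 2$ matrices over $\mathbb{F}$, and let $e_1,e_2,e_3,e_4$ be the standard basis of $\mathbb{F}^4$. Identify $\mathbb{F}^{2\times 2}$ with $\mathbb{F}^4$ via $e_{11}\mapsto e_1$, $e_{12}\mapsto e_2$, $e_{21}\mapsto e_3$, $e_{22}\mapsto e_4$, and let $\mathrm{GL}_4(\mathbb{F})^{\times 3}$ act on $\mathbb{F}^{2\times 2}\otimes\mathbb{F}^{2\times 2}\otimes\mathbb{F}^{2\times 2}$ accordingly, by $(A,B,C)\cdot(u\otimes v\otimes w)=Au\otimes Bv\otimes Cw$. The matrix multiplication tensor is $\langle 2,2,2\rangle=\sum_{i,j,k\in\{1,2\}} e_{ij}\otimes e_{jk}\otimes e_{ki}$. The support of a tensor is the set of coordinates (with respect to the basis $\{e_{ij}\otimes e_{kl}\otimes e_{mn}\}$) at which its coefficient is nonzero. -}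

module Defs where

open import Level using (Level; _⊔_)
open import Algebra.Bundles using (CommutativeRing)
open import Data.Nat using (ℕ)
open import Data.Fin using (Fin; zero; suc; _≟_)
open import Data.Product using (Σ; _×_; _,_)
open import Relation.Nullary using (¬_; yes; no)
open import Function.Bundles using (_⇔_)

record Field (c ℓ : Level) : Set (Level.suc (c ⊔ ℓ)) where
  field
    commutativeRing : CommutativeRing c ℓ
  open CommutativeRing commutativeRing public
  field
    1≉0     : ¬ (1# ≈ 0#)
    inverse : ∀ x → ¬ (x ≈ 0#) → Σ Carrier λ y → x * y ≈ 1#

-- Identification of the basis e₁₁,e₁₂,e₂₁,e₂₂ of 𝔽^{2×2} with e₁,…,e₄ of 𝔽⁴
-- (indices 0-based: e_{ij} ↦ index 2i+j, i,j ∈ {0,1}).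
idx : Fin 2 → Fin 2 → Fin 4
idx zero       zero       = zero
idx zero       (suc zero) = suc zero
idx (suc zero) zero       = suc (suc zero)
idx (suc zero) (suc zero) = suc (suc (suc zero))

module OverField {c ℓ : Level} (𝔽 : Field c ℓ) where
  open Field 𝔽 using (Carrier; _≈_; _+_; _*_; 0#; 1#)

  Σᶠ : ∀ {n : ℕ} → (Fin n → Carrier) → Carrier
  Σᶠ {ℕ.zero}  f = 0#
  Σᶠ {ℕ.suc n} f = f zero + Σᶠ (λ i → f (suc i))

  δ : ∀ {n : ℕ} → Fin n → Fin n → Carrier
  δ i j with i ≟ j
  ... | yes _ = 1#
  ... | no  _ = 0#

  Tensor : Set c
  Tensor = Fin 4 → Fin 4 → Fin 4 → Carrier

  Matrix : Set c
  Matrix = Fin 4 → Fin 4 → Carrier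

  _·ₘ_ : Matrix → Matrix → Matrix
  (A ·ₘ B) i j = Σᶠ λ k → A i k * B k j

  I₄ : Matrix
  I₄ = δ

  _≈ₘ_ : Matrix → Matrix → Set ℓ
  A ≈ₘ B = ∀ i j → A i j ≈ B i j

  Invertible : Matrix → Set (c ⊔ ℓ)
  Invertible A = Σ Matrix λ A⁻¹ → ((A ·ₘ A⁻¹) ≈ₘ I₄) × ((A⁻¹ ·ₘ A) ≈ₘ I₄)

  -- (A,B,C)·t, extending (A,B,C)·(u⊗v⊗w) = Au⊗Bv⊗Cw linearly
  act : Matrix → Matrix → Matrix → Tensor → Tensor
  act A B C t x y z =
    Σᶠ λ a → Σᶠ λ b → Σᶠ λ d → ((A x a * B y b) * C z d) * t a b d

  _≈ₜ_ : Tensor → Tensor → Set ℓ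
  s ≈ₜ t = ∀ x y z → s x y z ≈ t x y z

  InOrbit : Tensor → Tensor → Set (c ⊔ ℓ)
  InOrbit t s = Σ Matrix λ A → Σ Matrix λ B → Σ Matrix λ C →
    Invertible A × Invertible B × Invertible C × (s ≈ₜ act A B C t)

  mm222 : Tensor
  mm222 x y z = Σᶠ λ i → Σᶠ λ j → Σᶠ λ k →
    (δ x (idx i j) * δ y (idx j k)) * δ z (idx k i)

  InSupport : Tensor → Fin 4 → Fin 4 → Fin 4 → Set ℓ
  InSupport t x y z = ¬ (t x y z ≈ 0#)

  SameSupport : Tensor → Tensor → Set ℓ
  SameSupport s t = ∀ x y z → InSupport s x y z ⇔ InSupport t x y z

module Submission where

-- Rescaling the three tensor factors by diagonal matrices diag α, diag β,
-- diag γ with unit entries multiplies the coefficient of t at (x,y,z) by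
-- α x β y γ z.  Such a rescaling stays in the GL₄(𝔽)^{×3}-orbit and keeps
-- the support.  The support of ⟨2,2,2⟩ consists of the eight triples
-- (e_ij, e_jk, e_ki); asking the seven coefficients other than e₁₁⊗e₁₁⊗e₁₁
-- to become 1 gives seven monomial equations in twelve unknowns.  After
-- fixing five scalars to 1 they can be solved one at a time: each remaining
-- unknown is the inverse of the product of the other factors of "its"
-- equation, all of which are already determined.

open import Level using (Level; _⊔_)
open import Algebra.Bundles using (CommutativeMonoid)
open import Data.Nat using (ℕ)
open import Data.Fin using (Fin; zero; suc; _≟_; combine)
open import Data.Fin.Patterns using (0F; 1F)
open import Data.Fin.Properties using (suc-injective; combine-injectiveˡ; combine-injectiveʳ; any?)
open import Data.Product using (Σ; ∃; _×_; _,_; proj₁; proj₂)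
open import Data.Vec.Functional using ([]; _∷_)
open import Relation.Nullary using (¬_; Dec; yes; no)
open import Relation.Nullary.Negation using (contradiction)
open import Relation.Nullary.Decidable using (_×-dec_)
open import Relation.Binary.PropositionalEquality using (_≡_; _≢_)
import Relation.Binary.PropositionalEquality as PE
open import Function using (_∘_)
open import Function.Bundles using (Equivalence; mk⇔)
open import Defs

module Units {a ℓ : Level} (M : CommutativeMonoid a ℓ) where
  open CommutativeMonoid M renaming (_∙_ to _*_; ε to 1#)
  open import Algebra.Properties.CommutativeSemigroup commutativeSemigroup
    using (interchange; xy∙z≈xz∙y)

  record Unit : Set (a ⊔ ℓ) where
    field
      val inv : Carrier
      val*inv : val * inv ≈ 1#
  open Unit public

  1ᵘ : Unit
  1ᵘ = record { val = 1# ; inv = 1# ; val*inv = identityˡ 1# }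

  infixl 7 _·_
  _·_ : Unit → Unit → Unit
  u · v = record
    { val = val u * val v
    ; inv = inv u * inv v
    ; val*inv = trans (interchange _ _ _ _) (trans (∙-cong (val*inv u) (val*inv v)) (identityˡ 1#))
    }

  infix 8 _⁻¹
  _⁻¹ : Unit → Unit
  u ⁻¹ = record { val = inv u ; inv = val u ; val*inv = trans (comm _ _) (val*inv u) }

  solved-by-first : (b c t : Unit) → ((val ((b · c · t) ⁻¹) * val b) * val c) * val t ≈ 1#
  solved-by-first b c t =
    trans (∙-congʳ (trans (assoc _ _ _) (comm _ _)))
          (trans (xy∙z≈xz∙y _ _ _) (val*inv (b · c · t)))

  solved-by-second : (a c t : Unit) → ((val a * val ((a · c · t) ⁻¹)) * val c) * val t ≈ 1#
  solved-by-second a c t =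
    trans (∙-congʳ (xy∙z≈xz∙y _ _ _)) (trans (xy∙z≈xz∙y _ _ _) (val*inv (a · c · t)))

  solved-by-third : (a b t : Unit) → ((val a * val b) * val ((a · b · t) ⁻¹)) * val t ≈ 1#
  solved-by-third a b t = trans (xy∙z≈xz∙y _ _ _) (val*inv (a · b · t))

module Proof {c ℓ : Level} (𝔽 : Field c ℓ) where
  open Field 𝔽 hiding (zero)
  open OverField 𝔽
  open Units *-commutativeMonoid
    using (Unit; val; inv; val*inv; 1ᵘ; _·_; _⁻¹; solved-by-first; solved-by-second; solved-by-third)
  open import Relation.Binary.Reasoning.Setoid setoid

  *-absorbˡ : ∀ {a b} → a ≈ 0# → a * b ≈ 0#
  *-absorbˡ {b = b} a≈0 = trans (*-congʳ a≈0) (zeroˡ b)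

  *-absorbʳ : ∀ {a b} → b ≈ 0# → a * b ≈ 0#
  *-absorbʳ {a = a} b≈0 = trans (*-congˡ b≈0) (zeroʳ a)

  nonzero-unit : (a : Carrier) → ¬ (a ≈ 0#) → Unit
  nonzero-unit a a≉0 = record
    { val = a ; inv = proj₁ (inverse a a≉0) ; val*inv = proj₂ (inverse a a≉0) }

  unit-*-zero : (u : Unit) {a : Carrier} → val u * a ≈ 0# → a ≈ 0#
  unit-*-zero u {a} ua≈0 = begin
    a                    ≈⟨ *-identityˡ a ⟨
    1# * a               ≈⟨ *-congʳ (val*inv (u ⁻¹)) ⟨
    (inv u * val u) * a  ≈⟨ *-assoc _ _ _ ⟩
    inv u * (val u * a)  ≈⟨ *-absorbʳ ua≈0 ⟩
    0#                   ∎

  Σᶠ-zero : ∀ {n} (f : Fin n → Carrier) → (∀ i → f i ≈ 0#) → Σᶠ f ≈ 0#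
  Σᶠ-zero {ℕ.zero}  f f≈0 = refl
  Σᶠ-zero {ℕ.suc n} f f≈0 =
    trans (+-cong (f≈0 zero) (Σᶠ-zero (f ∘ suc) (f≈0 ∘ suc))) (+-identityˡ 0#)

  Σᶠ-single : ∀ {n} (i : Fin n) (f : Fin n → Carrier) → (∀ j → i ≢ j → f j ≈ 0#) → Σᶠ f ≈ f i
  Σᶠ-single zero f off =
    trans (+-congˡ (Σᶠ-zero (f ∘ suc) (λ j → off (suc j) λ ()))) (+-identityʳ (f zero))
  Σᶠ-single (suc i) f off =
    trans (+-cong (off zero λ ())
                  (Σᶠ-single i (f ∘ suc) λ j i≢j → off (suc j) (i≢j ∘ suc-injective)))
          (+-identityˡ (f (suc i)))

  δ-diag : ∀ {n} (i : Fin n) → δ i i ≈ 1#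
  δ-diag i with i ≟ i
  ... | yes _  = refl
  ... | no i≢i = contradiction PE.refl i≢i

  δ-off : ∀ {n} {i j : Fin n} → i ≢ j → δ i j ≈ 0#
  δ-off {i = i} {j} i≢j with i ≟ j
  ... | yes i≡j = contradiction i≡j i≢j
  ... | no _    = refl

  diag : (Fin 4 → Carrier) → Matrix
  diag d i j = δ i j * d j

  diag-on : ∀ (d : Fin 4 → Carrier) i → diag d i i ≈ d i
  diag-on d i = trans (*-congʳ (δ-diag i)) (*-identityˡ (d i))

  diag-off : ∀ (d : Fin 4 → Carrier) {i j} → i ≢ j → diag d i j ≈ 0#
  diag-off d i≢j = *-absorbˡ (δ-off i≢j)

  diag-inverse : ∀ (a b : Fin 4 → Carrier) → (∀ i → a i * b i ≈ 1#) → (diag a ·ₘ diag b) ≈ₘ I₄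
  diag-inverse a b ab≈1 i j = begin
    Σᶠ (λ k → diag a i k * diag b k j)
      ≈⟨ Σᶠ-single i _ (λ k i≢k → *-absorbˡ {b = diag b k j} (diag-off a i≢k)) ⟩
    diag a i i * diag b i j  ≈⟨ *-congʳ (diag-on a i) ⟩
    a i * diag b i j         ≈⟨ entry (i ≟ j) ⟩
    δ i j                    ∎
    where
    entry : Dec (i ≡ j) → a i * diag b i j ≈ δ i j
    entry (yes PE.refl) = trans (*-congˡ (diag-on b i)) (trans (ab≈1 i) (sym (δ-diag i)))
    entry (no i≢j)      = trans (*-absorbʳ (diag-off b i≢j)) (sym (δ-off i≢j))

  diag-invertible : (u : Fin 4 → Unit) → Invertible (diag (val ∘ u))
  diag-invertible u = diag (inv ∘ u) ,
    diag-inverse (val ∘ u) (inv ∘ u) (λ i → val*inv (u i)) ,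
    diag-inverse (inv ∘ u) (val ∘ u) (λ i → val*inv (u i ⁻¹))

  act-diag : ∀ (α β γ : Fin 4 → Carrier) (t : Tensor) x y z →
    act (diag α) (diag β) (diag γ) t x y z ≈ ((α x * β y) * γ z) * t x y z
  act-diag α β γ t x y z = begin
    Σᶠ (λ p → Σᶠ λ q → Σᶠ λ r → κ p q r)
      ≈⟨ Σᶠ-single x (λ p → Σᶠ λ q → Σᶠ λ r → κ p q r) (λ p x≢p →
           Σᶠ-zero (λ q → Σᶠ (κ p q)) λ q → Σᶠ-zero (κ p q) λ r →
             *-absorbˡ (*-absorbˡ (*-absorbˡ (diag-off α x≢p)))) ⟩
    Σᶠ (λ q → Σᶠ λ r → κ x q r)
      ≈⟨ Σᶠ-single y (λ q → Σᶠ (κ x q)) (λ q y≢q →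
           Σᶠ-zero (κ x q) λ r → *-absorbˡ (*-absorbˡ (*-absorbʳ (diag-off β y≢q)))) ⟩
    Σᶠ (κ x y)
      ≈⟨ Σᶠ-single z (κ x y) (λ r z≢r → *-absorbˡ (*-absorbʳ (diag-off γ z≢r))) ⟩
    κ x y z
      ≈⟨ *-congʳ (*-cong (*-cong (diag-on α x) (diag-on β y)) (diag-on γ z)) ⟩
    ((α x * β y) * γ z) * t x y z
      ∎
    where
    κ : Fin 4 → Fin 4 → Fin 4 → Carrier
    κ p q r = ((diag α x p * diag β y q) * diag γ z r) * t p q r

  rescale : (α β γ : Fin 4 → Unit) → Tensor → Tensor
  rescale α β γ t x y z = ((val (α x) * val (β y)) * val (γ z)) * t x y z

  rescale-in-orbit : ∀ α β γ (t : Tensor) → InOrbit t (rescale α β γ t)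
  rescale-in-orbit α β γ t =
    diag (val ∘ α) , diag (val ∘ β) , diag (val ∘ γ) ,
    diag-invertible α , diag-invertible β , diag-invertible γ ,
    λ x y z → sym (act-diag (val ∘ α) (val ∘ β) (val ∘ γ) t x y z)

  rescale-same-support : ∀ α β γ (t : Tensor) → SameSupport (rescale α β γ t) t
  rescale-same-support α β γ t x y z = mk⇔
    (λ s≉0 t≈0 → s≉0 (*-absorbʳ t≈0))
    (λ t≉0 s≈0 → t≉0 (unit-*-zero (α x · β y · γ z) s≈0))

  MMTriple : Fin 4 → Fin 4 → Fin 4 → Fin 2 → Fin 2 → Fin 2 → Set
  MMTriple x y z i j k = x ≡ idx i j × y ≡ idx j k × z ≡ idx k i

  idx≡combine : ∀ i j → idx i j ≡ combine i j
  idx≡combine 0F 0F = PE.refl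
  idx≡combine 0F 1F = PE.refl
  idx≡combine 1F 0F = PE.refl
  idx≡combine 1F 1F = PE.refl

  idx-injective : ∀ i j i′ j′ → idx i j ≡ idx i′ j′ → i ≡ i′ × j ≡ j′
  idx-injective i j i′ j′ eq =
    combine-injectiveˡ i j i′ j′ combine-eq , combine-injectiveʳ i j i′ j′ combine-eq
    where
    combine-eq : combine i j ≡ combine i′ j′
    combine-eq = PE.trans (PE.sym (idx≡combine i j)) (PE.trans eq (idx≡combine i′ j′))

  mm222-on : ∀ i j k → mm222 (idx i j) (idx j k) (idx k i) ≈ 1#
  mm222-on i j k = begin
    Σᶠ (λ i′ → Σᶠ λ j′ → Σᶠ λ k′ → κ i′ j′ k′)
      ≈⟨ Σᶠ-single i (λ i′ → Σᶠ λ j′ → Σᶠ λ k′ → κ i′ j′ k′) (λ i′ i≢i′ →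
           Σᶠ-zero (λ j′ → Σᶠ (κ i′ j′)) λ j′ → Σᶠ-zero (κ i′ j′) λ k′ →
             *-absorbˡ (*-absorbˡ (δ-off (i≢i′ ∘ proj₁ ∘ idx-injective i j i′ j′)))) ⟩
    Σᶠ (λ j′ → Σᶠ λ k′ → κ i j′ k′)
      ≈⟨ Σᶠ-single j (λ j′ → Σᶠ (κ i j′)) (λ j′ j≢j′ →
           Σᶠ-zero (κ i j′) λ k′ →
             *-absorbˡ (*-absorbˡ (δ-off (j≢j′ ∘ proj₂ ∘ idx-injective i j i j′)))) ⟩
    Σᶠ (κ i j)
      ≈⟨ Σᶠ-single k (κ i j) (λ k′ k≢k′ →
           *-absorbˡ (*-absorbʳ (δ-off (k≢k′ ∘ proj₂ ∘ idx-injective j k j k′)))) ⟩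
    κ i j k
      ≈⟨ *-cong (*-cong (δ-diag (idx i j)) (δ-diag (idx j k))) (δ-diag (idx k i)) ⟩
    (1# * 1#) * 1#
      ≈⟨ trans (*-congʳ (*-identityˡ 1#)) (*-identityˡ 1#) ⟩
    1#
      ∎
    where
    κ : Fin 2 → Fin 2 → Fin 2 → Carrier
    κ i′ j′ k′ = (δ (idx i j) (idx i′ j′) * δ (idx j k) (idx j′ k′)) * δ (idx k i) (idx k′ i′)

  mm222-off : ∀ x y z → (∀ i j k → ¬ MMTriple x y z i j k) → mm222 x y z ≈ 0#
  mm222-off x y z off =
    Σᶠ-zero _ λ i → Σᶠ-zero _ λ j → Σᶠ-zero _ λ k →
      summand-zero i j k (x ≟ idx i j) (y ≟ idx j k) (z ≟ idx k i)
    where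
    summand-zero : ∀ i j k → Dec (x ≡ idx i j) → Dec (y ≡ idx j k) → Dec (z ≡ idx k i) →
      (δ x (idx i j) * δ y (idx j k)) * δ z (idx k i) ≈ 0#
    summand-zero i j k (no x≢)  _        _        = *-absorbˡ (*-absorbˡ (δ-off x≢))
    summand-zero i j k (yes _)  (no y≢)  _        = *-absorbˡ (*-absorbʳ (δ-off y≢))
    summand-zero i j k (yes _)  (yes _)  (no z≢)  = *-absorbʳ (δ-off z≢)
    summand-zero i j k (yes x≡) (yes y≡) (yes z≡) = contradiction (x≡ , y≡ , z≡) (off i j k)

  support-mm222 : ∀ (t : Tensor) → SameSupport t mm222 → ∀ x y z → InSupport t x y z →
    ∃ λ i → ∃ λ j → ∃ λ k → MMTriple x y z i j k
  support-mm222 t sst x y z t≉0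
    with any? (λ i → any? λ j → any? λ k → (x ≟ idx i j) ×-dec (y ≟ idx j k) ×-dec (z ≟ idx k i))
  ... | yes triple = triple
  ... | no ¬triple = contradiction (mm222-off x y z λ i j k m → ¬triple (i , j , k , m))
                                   (Equivalence.to (sst x y z) t≉0)

  module Normalisation (t : Tensor) (sst : SameSupport t mm222) where

    tᵘ : Fin 2 → Fin 2 → Fin 2 → Unit
    tᵘ i j k = nonzero-unit (t (idx i j) (idx j k) (idx k i))
      (Equivalence.from (sst _ _ _) λ mm≈0 → 1≉0 (trans (sym (mm222-on i j k)) mm≈0))

    -- With α₀ = α₃ = β₁ = β₂ = β₃ = 1, each remaining scalar is solved from
    -- the equation α_x β_y γ_z t_xyz = 1 of the triple (i,j,k) named in its
    -- definition, in an order where the other factors are already known.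
    γ₂ γ₁ γ₃ α₁ α₂ γ₀ β₀ : Unit
    γ₂ = (1ᵘ · 1ᵘ · tᵘ 0F 0F 1F) ⁻¹
    γ₁ = (1ᵘ · 1ᵘ · tᵘ 1F 1F 0F) ⁻¹
    γ₃ = (1ᵘ · 1ᵘ · tᵘ 1F 1F 1F) ⁻¹
    α₁ = (1ᵘ · γ₂ · tᵘ 0F 1F 1F) ⁻¹
    α₂ = (1ᵘ · γ₃ · tᵘ 1F 0F 1F) ⁻¹
    γ₀ = (α₁ · 1ᵘ · tᵘ 0F 1F 0F) ⁻¹
    β₀ = (α₂ · γ₁ · tᵘ 1F 0F 0F) ⁻¹

    α β γ : Fin 4 → Unit
    α = 1ᵘ ∷ α₁ ∷ α₂ ∷ 1ᵘ ∷ []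
    β = β₀ ∷ 1ᵘ ∷ 1ᵘ ∷ 1ᵘ ∷ []
    γ = γ₀ ∷ γ₁ ∷ γ₂ ∷ γ₃ ∷ []

    s : Tensor
    s = rescale α β γ t

    normalised-at : ∀ i j k → ¬ (idx i j ≡ zero × idx j k ≡ zero × idx k i ≡ zero) →
      s (idx i j) (idx j k) (idx k i) ≈ 1#
    normalised-at 0F 0F 0F origin = contradiction (PE.refl , PE.refl , PE.refl) origin
    normalised-at 0F 0F 1F _ = solved-by-third 1ᵘ 1ᵘ (tᵘ 0F 0F 1F)
    normalised-at 0F 1F 0F _ = solved-by-third α₁ 1ᵘ (tᵘ 0F 1F 0F)
    normalised-at 0F 1F 1F _ = solved-by-first 1ᵘ γ₂ (tᵘ 0F 1F 1F)
    normalised-at 1F 0F 0F _ = solved-by-second α₂ γ₁ (tᵘ 1F 0F 0F)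
    normalised-at 1F 0F 1F _ = solved-by-first 1ᵘ γ₃ (tᵘ 1F 0F 1F)
    normalised-at 1F 1F 0F _ = solved-by-third 1ᵘ 1ᵘ (tᵘ 1F 1F 0F)
    normalised-at 1F 1F 1F _ = solved-by-third 1ᵘ 1ᵘ (tᵘ 1F 1F 1F)

    normalised-triple : ∀ {x y z} → (∃ λ i → ∃ λ j → ∃ λ k → MMTriple x y z i j k) →
      ¬ (x ≡ zero × y ≡ zero × z ≡ zero) → s x y z ≈ 1#
    normalised-triple (i , j , k , PE.refl , PE.refl , PE.refl) = normalised-at i j k

    normalised : (x y z : Fin 4) → InSupport s x y z → ¬ (x ≡ zero × y ≡ zero × z ≡ zero) →
      s x y z ≈ 1#
    normalised x y z s≉0 = normalised-triple
      (support-mm222 t sst x y z (Equivalence.to (rescale-same-support α β γ t x y z) s≉0))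

lemma2p1 : {c ℓ : Level} (𝔽 : Field c ℓ) → let open OverField 𝔽 in
    (t : Tensor) → SameSupport t mm222 →
    Σ Tensor λ s → InOrbit t s × SameSupport s t ×
      ((x y z : Fin 4) → InSupport s x y z → ¬ ((x ≡ zero) × (y ≡ zero) × (z ≡ zero)) →
        Field._≈_ 𝔽 (s x y z) (Field.1# 𝔽))
lemma2p1 𝔽 t sst = s , rescale-in-orbit α β γ t , rescale-same-support α β γ t , normalised
  where
  open Proof 𝔽
  open Normalisation t sst
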